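{- Define $b_0=b_1=1$ and $b_{n+2}=b_{n+1}+\sum_{k=0}^{n}\binom{n}{k}b_k$ for $n\ge 0$. Then for every integer $n\ge 0$, each of the sets $\mathcal{S}_n(1\text{ - }23,\,3\text{ - }12)$, $\mathcal{S}_n(3\text{ - }21,\,1\text{ - }32)$, $\mathcal{S}_n(23\text{ - }1,\,12\text{ - }3)$, $\mathcal{S}_n(32\text{ - }1,\,21\text{ - }3)$ has cardinality $b_n$.
   Context: A permutation of $[n]=\{1,\dots,n\}$ is written as a word $\pi=a_1a_2\cdots a_n$. For a permutation $xyz$ of $\{1,2,3\}$: $\pi$ contains the pattern $x\text{ - }yz$ if there are indices $1\le i<j<n$ such that $a_i,a_j,a_{j+1}$ are in the same relative order as $x,y,z$; $\pi$ contains the pattern $xy\text{ - }z$ if there are indices $i$ and $k$ with $i+1<k\le n$ such that $a_i,a_{i+1},a_k$ are in the same relative order as $x,y,z$. $\pi$ avoids a pattern if it does not contain it. $\mathcal{S}_n(p,q)$ is the set of permutations of $[n]$ avoiding both $p$ and $q$. -}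

module Defs where

open import Data.Nat using (ℕ; zero; suc; _+_; _*_; _<_)
open import Data.Nat.Combinatorics using (_C_)
open import Data.List using (List; []; _∷_; _++_; [_]; map; upTo; length)
open import Data.Nat.ListAction using (sum)
open import Data.Fin using (Fin; toℕ)
open import Data.Vec using (Vec; lookup)
open import Data.Product using (Σ; ∃; ∃-syntax; _×_)
open import Function.Bundles using (_⇔_)
open import Relation.Binary.PropositionalEquality using (_≡_)

at : List ℕ → ℕ → ℕ
at []       _       = 0
at (x ∷ _)  zero    = x
at (_ ∷ xs) (suc k) = at xs k

-- bs n = [ b_0 , b_1 , … , b_{n+1} ]
bs : ℕ → List ℕ
bs zero    = 1 ∷ 1 ∷ []
bs (suc n) = bs n ++ [ at (bs n) (suc n)
                       + sum (map (λ k → (n C k) * at (bs n) k) (upTo (suc n))) ]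

b : ℕ → ℕ
b n = at (bs n) n

-- Permutations of [n] as words a_0 a_1 … a_{n-1} with letters in Fin n
-- (0-based positions and values; relative order is unaffected).

Word : ℕ → Set
Word n = Vec (Fin n) n

IsPerm : ∀ {n} → Word n → Set
IsPerm {n} w = ∀ (i j : Fin n) → lookup w i ≡ lookup w j → i ≡ j

SameOrder : ℕ → ℕ → ℕ → ℕ → ℕ → ℕ → Set
SameOrder a b c x y z = ((a < b) ⇔ (x < y)) × ((a < c) ⇔ (x < z)) × ((b < c) ⇔ (y < z))

Contains-x-yz : ∀ {n} → Word n → ℕ → ℕ → ℕ → Set
Contains-x-yz {n} w x y z =
  ∃[ i ] ∃[ j ] ∃[ k ] (toℕ i < toℕ j) × (toℕ k ≡ suc (toℕ j)) ×
    SameOrder (toℕ (lookup w i)) (toℕ (lookup w j)) (toℕ (lookup w k)) x y z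

Contains-xy-z : ∀ {n} → Word n → ℕ → ℕ → ℕ → Set
Contains-xy-z {n} w x y z =
  ∃[ i ] ∃[ j ] ∃[ k ] (toℕ j ≡ suc (toℕ i)) × (toℕ j < toℕ k) ×
    SameOrder (toℕ (lookup w i)) (toℕ (lookup w j)) (toℕ (lookup w k)) x y z

{-# OPTIONS --safe #-}
module Submission where

-- Write a permutation of [m+2] as its first letter v followed by the standardisation σ of the
-- remaining letters. Both 32-1 and 21-3 begin with a descent, so the only new occurrences in v σ
-- start at a front descent v > σ₁, and avoiding them forces every later letter to lie strictly
-- between σ₁ and v. Hence v σ avoids both patterns iff σ does and either v ≤ σ₁ or v is the
-- largest and σ₁ the smallest letter. Counting avoiders by their first letter gives a triangle
-- whose tail sums obey Pascal's rule; this yields exactly the recurrence of b. The other three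
-- classes are images of this one under reversal and complementation, which exchange x-yz with
-- zy-x and x y z with 4-x 4-y 4-z.

open import Defs
open import Data.Bool using (Bool; true; false; if_then_else_; T)
open import Data.Fin as Fin using (Fin; zero; suc; toℕ; punchIn; punchOut; opposite)
open import Data.Fin.Properties
  using ( toℕ<n; toℕ-inject₁; toℕ-fromℕ; toℕ-injective; any?; pigeonhole
        ; punchIn-injective; punchInᵢ≢i; punchIn-mono-≤; punchIn-cancel-≤; punchOut-injective; punchIn-punchOut
        ; opposite-prop; opposite-involutive )
import Data.Fin.Properties as Finₚ
open import Data.List as List using (List; []; _∷_; _++_; [_]; upTo; applyUpTo; length)
open import Data.List.Membership.Propositional using (_∈_)
open import Data.List.Membership.Propositional.Properties
  using (∈-map⁺; ∈-map⁻; ∈-concat⁺′; ∈-concat⁻′; ∈-tabulate⁺; ∈-tabulate⁻)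
open import Data.List.Properties using (length-++; length-map)
import Data.List.Relation.Unary.All as All
import Data.List.Relation.Unary.All.Properties as Allₚ
open import Data.List.Relation.Unary.AllPairs using ([]; _∷_)
open import Data.List.Relation.Unary.AllPairs.Properties using (tabulate⁺-<)
open import Data.List.Relation.Unary.Any using (here)
open import Data.List.Relation.Unary.Unique.Propositional using (Unique)
open import Data.List.Relation.Unary.Unique.Propositional.Properties using (map⁺; concat⁺)
open import Data.Nat
open import Data.Nat.Combinatorics using (_C_; nCk+nC[k+1]≡[n+1]C[k+1]; k>n⇒nCk≡0)
open import Data.Nat.Induction using (<-rec)
open import Data.Nat.ListAction using (sum)
open import Data.Nat.Properties
open import Data.Product using (∃-syntax; _×_; _,_; proj₁; proj₂)
open import Data.Sum using (_⊎_; inj₁; inj₂)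
open import Data.Vec as Vec using (Vec; []; _∷_; lookup; tabulate)
open import Data.Vec.Properties
  using ( lookup-map; map-∘; map-cong; map-id; ∷-injectiveˡ; ∷-injectiveʳ
        ; tabulate-∘; tabulate-cong; tabulate∘lookup; lookup∘tabulate )
open import Function using (_∘_; id)
open import Function.Bundles using (_⇔_; mk⇔; Equivalence)
open import Function.Construct.Composition using (_⇔-∘_)
open import Function.Construct.Symmetry using (⇔-sym)
open import Relation.Binary.PropositionalEquality hiding ([_])
open import Relation.Nullary using (¬_; yes; no; contradiction)
open import Relation.Nullary.Decidable using (dec-true; dec-false; from-yes; from-no)

open import Algebra.Properties.CommutativeMonoid.Sum +-0-commutativeMonoid
  using (sum-syntax; sum⁺-syntax; sum-cong-≗; sum-init-last; sum-replicate-zero; ∑-distrib-+)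
open import Algebra.Properties.CommutativeSemigroup +-commutativeSemigroup using (x∙yz≈y∙xz)

open ≡-Reasoning
open Equivalence using (to; from)

binomialTransform : (ℕ → ℕ) → ℕ → ℕ
binomialTransform x n = ∑[ k ≤ n ] ((n C toℕ k) * x (toℕ k))

binomialTransform-cong : ∀ n {x y : ℕ → ℕ} → (∀ (k : Fin (suc n)) → x (toℕ k) ≡ y (toℕ k)) →
  binomialTransform x n ≡ binomialTransform y n
binomialTransform-cong n x≗y = sum-cong-≗ {suc n} λ k → cong ((n C toℕ k) *_) (x≗y k)

binomialTransform-suc : ∀ (x : ℕ → ℕ) n →
  binomialTransform x (suc n) ≡ binomialTransform x n + binomialTransform (x ∘ suc) n
binomialTransform-suc x n = begin
  1 * x 0 + ∑[ k ≤ n ] ((suc n C suc (toℕ k)) * x (suc (toℕ k)))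
    ≡⟨ cong (1 * x 0 +_) (sum-cong-≗ {suc n} λ k → pascal (toℕ k)) ⟩
  1 * x 0 + ∑[ k ≤ n ] (u (toℕ k) + v (toℕ k))
    ≡⟨ cong (1 * x 0 +_) (∑-distrib-+ {suc n} (u ∘ toℕ) (v ∘ toℕ)) ⟩
  1 * x 0 + (binomialTransform (x ∘ suc) n + ∑[ k ≤ n ] v (toℕ k))
    ≡⟨ x∙yz≈y∙xz (1 * x 0) (binomialTransform (x ∘ suc) n) (∑[ k ≤ n ] v (toℕ k)) ⟩
  binomialTransform (x ∘ suc) n + (1 * x 0 + ∑[ k ≤ n ] v (toℕ k))
    ≡⟨ cong (λ s → binomialTransform (x ∘ suc) n + (1 * x 0 + s)) v-sum ⟩
  binomialTransform (x ∘ suc) n + binomialTransform x n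
    ≡⟨ +-comm (binomialTransform (x ∘ suc) n) (binomialTransform x n) ⟩
  binomialTransform x n + binomialTransform (x ∘ suc) n ∎
  where
  u v : ℕ → ℕ
  u k = (n C k) * x (suc k)
  v k = (n C suc k) * x (suc k)
  pascal : ∀ k → (suc n C suc k) * x (suc k) ≡ u k + v k
  pascal k = begin
    (suc n C suc k) * x (suc k)     ≡⟨ cong (_* x (suc k)) (nCk+nC[k+1]≡[n+1]C[k+1] n k) ⟨
    (n C k + n C suc k) * x (suc k) ≡⟨ *-distribʳ-+ (x (suc k)) (n C k) (n C suc k) ⟩
    u k + v k                       ∎
  v-sum : ∑[ k ≤ n ] v (toℕ k) ≡ ∑[ k < n ] v (toℕ k)
  v-sum = begin
    ∑[ k ≤ n ] v (toℕ k)
      ≡⟨ sum-init-last {n} (v ∘ toℕ) ⟩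
    ∑[ k < n ] v (toℕ (Fin.inject₁ k)) + v (toℕ (Fin.fromℕ n))
      ≡⟨ cong₂ _+_ (sum-cong-≗ {n} (cong v ∘ toℕ-inject₁)) (cong v (toℕ-fromℕ n)) ⟩
    ∑[ k < n ] v (toℕ k) + v n
      ≡⟨ cong (λ c → ∑[ k < n ] v (toℕ k) + c * x (suc n)) (k>n⇒nCk≡0 (n<1+n n)) ⟩
    ∑[ k < n ] v (toℕ k) + 0
      ≡⟨ +-identityʳ _ ⟩
    ∑[ k < n ] v (toℕ k) ∎

at-++ˡ : ∀ (xs ys : List ℕ) {k} → k < length xs → at (xs ++ ys) k ≡ at xs k
at-++ˡ (x ∷ xs) ys {zero}  _         = refl
at-++ˡ (x ∷ xs) ys {suc k} (s≤s k<n) = at-++ˡ xs ys k<n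

at-∷ʳ-length : ∀ (xs : List ℕ) y → at (xs ++ [ y ]) (length xs) ≡ y
at-∷ʳ-length []       y = refl
at-∷ʳ-length (x ∷ xs) y = at-∷ʳ-length xs y

length-bs : ∀ n → length (bs n) ≡ suc (suc n)
length-bs zero    = refl
length-bs (suc n) =
  trans (length-++ (bs n)) (trans (cong (_+ 1) (length-bs n)) (+-comm (suc (suc n)) 1))

at-bs-suc : ∀ n {k} → k < suc (suc n) → at (bs (suc n)) k ≡ at (bs n) k
at-bs-suc n k<2+n = at-++ˡ (bs n) _ (subst (_ <_) (sym (length-bs n)) k<2+n)

at-bs : ∀ n {k} → k ≤ suc n → at (bs n) k ≡ b k
at-bs zero    {zero}        _ = refl
at-bs zero    {suc zero}    _ = refl
at-bs zero    {2+ k}        (s≤s ())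
at-bs (suc n) {k} k≤2+n with m≤n⇒m<n∨m≡n k≤2+n
... | inj₁ (s≤s k≤1+n) = trans (at-bs-suc n (s≤s k≤1+n)) (at-bs n k≤1+n)
... | inj₂ refl         = sym (at-bs-suc (suc n) ≤-refl)

sum-map-applyUpTo : ∀ (g f : ℕ → ℕ) n → sum (List.map g (applyUpTo f n)) ≡ ∑[ k < n ] g (f (toℕ k))
sum-map-applyUpTo g f zero    = refl
sum-map-applyUpTo g f (suc n) = cong (g (f 0) +_) (sum-map-applyUpTo g (f ∘ suc) n)

b-suc-suc : ∀ n → b (suc (suc n)) ≡ b (suc n) + binomialTransform b n
b-suc-suc n = begin
  at (bs (suc (suc n))) (suc (suc n))   ≡⟨ at-bs-suc (suc n) ≤-refl ⟩
  at (bs n ++ [ new ]) (suc (suc n))    ≡⟨ cong (at (bs n ++ [ new ])) (length-bs n) ⟨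
  at (bs n ++ [ new ]) (length (bs n))  ≡⟨ at-∷ʳ-length (bs n) new ⟩
  new                                   ≡⟨ cong₂ _+_ (at-bs n ≤-refl) (sum-map-applyUpTo _ id (suc n)) ⟩
  b (suc n) + binomialTransform (at (bs n)) n
    ≡⟨ cong (b (suc n) +_)
            (binomialTransform-cong n {at (bs n)} {b} λ k → at-bs n (m≤n⇒m≤1+n (≤-pred (toℕ<n k)))) ⟩
  b (suc n) + binomialTransform b n     ∎
  where
  new = at (bs n) (suc n) + sum (List.map (λ k → (n C k) * at (bs n) k) (upTo (suc n)))

-- The counting triangle

-- allowed m x y: an avoider of length m + 2 may begin with x followed by the standardisation of
-- an avoider of length m + 1 beginning with y (prepend-avoids, prepend-avoids⁻).
allowed : ℕ → ℕ → ℕ → Bool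
allowed m x y = if x ≤ᵇ m then x ≤ᵇ y else y ≡ᵇ 0

-- count m x is the number of avoiders of length m + 1 starting with x (length-avoidersStartingWith);
-- for m = 0 only x = 0 is meaningful.
count : ℕ → ℕ → ℕ
count zero    _ = 1
count (suc m) x = ∑[ y ≤ m ] (if allowed m x (toℕ y) then count m (toℕ y) else 0)

countFrom : ℕ → ℕ → ℕ
countFrom m x = ∑[ i < suc m ∸ x ] count m (x + toℕ i)

sum-if-≤ᵇ : ∀ x n (g : ℕ → ℕ) →
  ∑[ y < n ] (if x ≤ᵇ toℕ y then g (toℕ y) else 0) ≡ ∑[ i < n ∸ x ] g (x + toℕ i)
-- The split on suc zero is needed because suc x ≤ᵇ suc y unfolds to x <ᵇ suc y, which is
-- x ≤ᵇ y only once x is a constructor.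
sum-if-≤ᵇ zero          n       g = refl
sum-if-≤ᵇ (suc x)       zero    g = refl
sum-if-≤ᵇ (suc zero)    (suc n) g = sum-if-≤ᵇ zero n (g ∘ suc)
sum-if-≤ᵇ (suc (suc x)) (suc n) g = sum-if-≤ᵇ (suc x) n (g ∘ suc)

-- does (x ≤? m) is x ≤ᵇ m by definition, so dec-true and dec-false evaluate the tests in allowed.
count-suc : ∀ m {x} → x ≤ m → count (suc m) x ≡ countFrom m x
count-suc m {x} x≤m rewrite dec-true (x ≤? m) x≤m = sum-if-≤ᵇ x (suc m) (count m)

count-suc-self : ∀ m → count (suc m) (suc m) ≡ count m 0
count-suc-self m rewrite dec-false (suc m ≤? m) (<-irrefl refl) = begin
  count m 0 + ∑[ y < m ] 0 ≡⟨ cong (count m 0 +_) (sum-replicate-zero m) ⟩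
  count m 0 + 0           ≡⟨ +-identityʳ (count m 0) ⟩
  count m 0               ∎

countFrom-suc : ∀ m {x} → x ≤ m → countFrom m x ≡ count m x + countFrom m (suc x)
countFrom-suc m {x} x≤m rewrite +-∸-assoc 1 x≤m =
  cong₂ _+_ (cong (count m) (+-identityʳ x)) (sum-cong-≗ {m ∸ x} λ i → cong (count m) (+-suc x (toℕ i)))

countFrom-empty : ∀ m → countFrom m (suc m) ≡ 0
countFrom-empty m rewrite n∸n≡0 m = refl

countFrom-binomialTransform : ∀ n j →
  countFrom (suc (j + n)) (suc j) ≡ binomialTransform (λ k → count (j + k) 0) n
countFrom-binomialTransform zero j rewrite +-identityʳ j = begin
  countFrom (suc j) (suc j)                         ≡⟨ countFrom-suc (suc j) ≤-refl ⟩
  count (suc j) (suc j) + countFrom (suc j) (2+ j)  ≡⟨ cong₂ _+_ (count-suc-self j) (countFrom-empty (suc j)) ⟩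
  count j 0 + 0                                     ≡⟨ cong (_+ 0) (*-identityˡ (count j 0)) ⟨
  1 * count j 0 + 0                                 ∎
countFrom-binomialTransform (suc n) j = begin
  countFrom (suc (j + suc n)) (suc j)
    ≡⟨ cong (λ m → countFrom (suc m) (suc j)) (+-suc j n) ⟩
  countFrom (2+ (j + n)) (suc j)
    ≡⟨ countFrom-suc (2+ (j + n)) (s≤s (m≤n⇒m≤1+n (m≤m+n j n))) ⟩
  count (2+ (j + n)) (suc j) + countFrom (2+ (j + n)) (2+ j)
    ≡⟨ cong (_+ countFrom (2+ (j + n)) (2+ j)) (count-suc (suc (j + n)) (s≤s (m≤m+n j n))) ⟩
  countFrom (suc (j + n)) (suc j) + countFrom (suc (suc j + n)) (suc (suc j))
    ≡⟨ cong₂ _+_ (countFrom-binomialTransform n j) (countFrom-binomialTransform n (suc j)) ⟩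
  binomialTransform (λ k → count (j + k) 0) n + binomialTransform (λ k → count (suc j + k) 0) n
    ≡⟨ cong (binomialTransform (λ k → count (j + k) 0) n +_)
            (binomialTransform-cong n {λ k → count (j + suc k) 0} {λ k → count (suc j + k) 0}
              λ k → cong (λ i → count i 0) (+-suc j (toℕ k))) ⟨
  binomialTransform (λ k → count (j + k) 0) n + binomialTransform (λ k → count (j + suc k) 0) n
    ≡⟨ binomialTransform-suc (λ k → count (j + k) 0) n ⟨
  binomialTransform (λ k → count (j + k) 0) (suc n) ∎

count-suc-suc-zero : ∀ m → count (2+ m) 0 ≡ count (suc m) 0 + binomialTransform (λ k → count k 0) m
count-suc-suc-zero m = begin
  count (2+ m) 0                                          ≡⟨ count-suc (suc m) z≤n ⟩
  countFrom (suc m) 0                                     ≡⟨ countFrom-suc (suc m) z≤n ⟩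
  count (suc m) 0 + countFrom (suc m) 1
    ≡⟨ cong (count (suc m) 0 +_) (countFrom-binomialTransform m 0) ⟩
  count (suc m) 0 + binomialTransform (λ k → count k 0) m ∎

count≡b : ∀ n → count n 0 ≡ b n
count≡b = <-rec (λ n → count n 0 ≡ b n) step
  where
  step : ∀ n → (∀ {k} → k < n → count k 0 ≡ b k) → count n 0 ≡ b n
  step zero           _  = refl
  step (suc zero)     _  = refl
  step (suc (suc m)) ih = begin
    count (2+ m) 0                                          ≡⟨ count-suc-suc-zero m ⟩
    count (suc m) 0 + binomialTransform (λ k → count k 0) m
      ≡⟨ cong₂ _+_ (ih ≤-refl)
                   (binomialTransform-cong m {λ k → count k 0} {b} λ k → ih (m<n⇒m<1+n (toℕ<n k))) ⟩
    b (suc m) + binomialTransform b m                       ≡⟨ b-suc-suc m ⟨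
    b (2+ m)                                                ∎

⇔-flip-< : ∀ {a b x y} → a ≢ b → x ≢ y → (a < b ⇔ x < y) → (b < a ⇔ y < x)
⇔-flip-< a≢b x≢y a<b⇔x<y = mk⇔
  (λ b<a → ≤∧≢⇒< (≮⇒≥ λ x<y → <-asym b<a (from a<b⇔x<y x<y)) (≢-sym x≢y))
  (λ y<x → ≤∧≢⇒< (≮⇒≥ λ a<b → <-asym y<x (to a<b⇔x<y a<b)) (≢-sym a≢b))

<-⇔-by-<ᵇ : ∀ {a b c d} → (a <ᵇ b) ≡ (c <ᵇ d) → (a < b ⇔ c < d)
<-⇔-by-<ᵇ {a} {b} {c} {d} eq = mk⇔
  (λ a<b → <ᵇ⇒< c d (subst T eq (<⇒<ᵇ a<b)))
  (λ c<d → <ᵇ⇒< a b (subst T (sym eq) (<⇒<ᵇ c<d)))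

both-false : ∀ {P Q : Set} → ¬ P → ¬ Q → P ⇔ Q
both-false ¬p ¬q = mk⇔ (λ p → contradiction p ¬p) (λ q → contradiction q ¬q)

both-true : ∀ {P Q : Set} → P → Q → P ⇔ Q
both-true p q = mk⇔ (λ _ → q) (λ _ → p)

Distinct : ℕ → ℕ → ℕ → Set
Distinct a b c = a ≢ b × a ≢ c × b ≢ c

OppositeOrder : ℕ → ℕ → ℕ → ℕ → ℕ → ℕ → Set
OppositeOrder a b c a′ b′ c′ = (a′ < b′ ⇔ b < a) × (a′ < c′ ⇔ c < a) × (b′ < c′ ⇔ c < b)

SameOrder-cong : ∀ {a b c a′ b′ c′ x y z} → (a′ < b′ ⇔ a < b) → (a′ < c′ ⇔ a < c) → (b′ < c′ ⇔ b < c) →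
  SameOrder a b c x y z → SameOrder a′ b′ c′ x y z
SameOrder-cong ab ac bc (ab′ , ac′ , bc′) = ab′ ⇔-∘ ab , ac′ ⇔-∘ ac , bc′ ⇔-∘ bc

SameOrder-reverse : ∀ {a b c x y z} → Distinct a b c → Distinct x y z →
  SameOrder a b c x y z → SameOrder c b a z y x
SameOrder-reverse (a≢b , a≢c , b≢c) (x≢y , x≢z , y≢z) (ab , ac , bc) =
  ⇔-flip-< b≢c y≢z bc , ⇔-flip-< a≢c x≢z ac , ⇔-flip-< a≢b x≢y ab

SameOrder-opposite : ∀ {a b c x y z a′ b′ c′ x′ y′ z′} → Distinct a b c → Distinct x y z →
  OppositeOrder a b c a′ b′ c′ → OppositeOrder x y z x′ y′ z′ →
  SameOrder a b c x y z → SameOrder a′ b′ c′ x′ y′ z′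
SameOrder-opposite (a≢b , a≢c , b≢c) (x≢y , x≢z , y≢z) (ab′ , ac′ , bc′) (xy′ , xz′ , yz′)
                   (ab , ac , bc) =
  ⇔-sym xy′ ⇔-∘ (⇔-flip-< a≢b x≢y ab ⇔-∘ ab′) ,
  ⇔-sym xz′ ⇔-∘ (⇔-flip-< a≢c x≢z ac ⇔-∘ ac′) ,
  ⇔-sym yz′ ⇔-∘ (⇔-flip-< b≢c y≢z bc ⇔-∘ bc′)

SameOrder-321 : ∀ {a b c} → c < b → b < a → SameOrder a b c 3 2 1
SameOrder-321 c<b b<a =
  both-false (<-asym b<a) (from-no (3 <? 2)) ,
  both-false (<-asym (<-trans c<b b<a)) (from-no (3 <? 1)) ,
  both-false (<-asym c<b) (from-no (2 <? 1))

SameOrder-213 : ∀ {a b c} → b < a → a < c → SameOrder a b c 2 1 3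
SameOrder-213 b<a a<c =
  both-false (<-asym b<a) (from-no (2 <? 1)) ,
  both-true a<c (from-yes (2 <? 3)) ,
  both-true (<-trans b<a a<c) (from-yes (1 <? 3))

Contains-xy-z′ : ∀ {N n} → Vec (Fin N) n → ℕ → ℕ → ℕ → Set
Contains-xy-z′ w x y z =
  ∃[ i ] ∃[ j ] ∃[ k ] (toℕ j ≡ suc (toℕ i)) × (toℕ j < toℕ k) ×
    SameOrder (toℕ (lookup w i)) (toℕ (lookup w j)) (toℕ (lookup w k)) x y z

Contains-xy-z′-∷∷ : ∀ {N n} (a b : Fin N) (τ : Vec (Fin N) n) {x y z} →
  Contains-xy-z′ (a ∷ b ∷ τ) x y z ⇔
    (Contains-xy-z′ (b ∷ τ) x y z ⊎ ∃[ k ] SameOrder (toℕ a) (toℕ b) (toℕ (lookup τ k)) x y z)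
Contains-xy-z′-∷∷ a b τ = mk⇔ split join
  where
  split : Contains-xy-z′ (a ∷ b ∷ τ) _ _ _ → _
  split (zero  , suc zero , suc (suc k) , _ , _ , ord) = inj₂ (k , ord)
  split (zero  , suc zero , suc zero , _ , s≤s () , _)
  split (zero  , suc (suc j) , _ , () , _)
  split (suc i , suc j , suc k , j≡1+i , s≤s j<k , ord) =
    inj₁ (i , j , k , suc-injective j≡1+i , j<k , ord)
  split (suc i , suc j , zero , _ , () , _)
  join : _ → Contains-xy-z′ (a ∷ b ∷ τ) _ _ _
  join (inj₁ (i , j , k , j≡1+i , j<k , ord)) = suc i , suc j , suc k , cong suc j≡1+i , s≤s j<k , ord
  join (inj₂ (k , ord))                       = zero , suc zero , suc (suc k) , refl , s≤s z<s , ord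

Contains-xy-z′-map : ∀ {N M n} (g : Fin N → Fin M) → (∀ a b → g a Fin.< g b ⇔ a Fin.< b) →
  (w : Vec (Fin N) n) → ∀ {x y z} → Contains-xy-z′ (Vec.map g w) x y z ⇔ Contains-xy-z′ w x y z
Contains-xy-z′-map g g-mono w = mk⇔
  (λ (i , j , k , adj , j<k , ord) →
     i , j , k , adj , j<k , SameOrder-cong (⇔-sym (mono i j)) (⇔-sym (mono i k)) (⇔-sym (mono j k)) ord)
  (λ (i , j , k , adj , j<k , ord) →
     i , j , k , adj , j<k , SameOrder-cong (mono i j) (mono i k) (mono j k) ord)
  where
  mono : ∀ i j → lookup (Vec.map g w) i Fin.< lookup (Vec.map g w) j ⇔ lookup w i Fin.< lookup w j
  mono i j rewrite lookup-map i g w | lookup-map j g w = g-mono (lookup w i) (lookup w j)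

IsPerm-distinct : ∀ {n} (w : Word n) → IsPerm w → ∀ {i j} → i ≢ j →
  toℕ (lookup w i) ≢ toℕ (lookup w j)
IsPerm-distinct w perm i≢j eq = i≢j (perm _ _ (toℕ-injective eq))

IsPerm-Distinct : ∀ {n} (w : Word n) → IsPerm w → ∀ {i j k} → i Fin.< j → j Fin.< k →
  Distinct (toℕ (lookup w i)) (toℕ (lookup w j)) (toℕ (lookup w k))
IsPerm-Distinct w perm i<j j<k =
  IsPerm-distinct w perm (Finₚ.<⇒≢ i<j) , IsPerm-distinct w perm (Finₚ.<⇒≢ (<-trans i<j j<k)) ,
  IsPerm-distinct w perm (Finₚ.<⇒≢ j<k)

IsPerm-surjective : ∀ {n} (w : Word n) → IsPerm w → ∀ y → ∃[ i ] lookup w i ≡ y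
IsPerm-surjective {suc n} w perm y with any? (λ i → lookup w i Fin.≟ y)
... | yes hit = hit
... | no miss = contradiction (perm i j (punchOut-injective (avoids i) (avoids j) same)) (Finₚ.<⇒≢ i<j)
  -- If y is missed, punchOut turns w into a map Fin (suc n) → Fin n, which must collide.
  where
  avoids : ∀ i → y ≢ lookup w i
  avoids i eq = miss (i , sym eq)
  collision = pigeonhole (n<1+n n) λ i → punchOut (avoids i)
  i = proj₁ collision
  j = proj₁ (proj₂ collision)
  i<j = proj₁ (proj₂ (proj₂ collision))
  same = proj₂ (proj₂ (proj₂ collision))

punchIn-<-⇔ : ∀ {n} (v : Fin (suc n)) (a b : Fin n) → punchIn v a Fin.< punchIn v b ⇔ a Fin.< b
punchIn-<-⇔ v a b = mk⇔
  (λ lt → ≰⇒> λ b≤a → <⇒≱ lt (punchIn-mono-≤ v b a b≤a))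
  (λ lt → ≰⇒> λ pb≤pa → <⇒≱ lt (punchIn-cancel-≤ v b a pb≤pa))

toℕ-punchIn-≥ : ∀ {n} (v : Fin (suc n)) (s : Fin n) → toℕ v ≤ toℕ s →
  toℕ (punchIn v s) ≡ suc (toℕ s)
toℕ-punchIn-≥ zero    s       _         = refl
toℕ-punchIn-≥ (suc v) (suc s) (s≤s v≤s) = cong suc (toℕ-punchIn-≥ v s v≤s)

toℕ-punchIn-< : ∀ {n} (v : Fin (suc n)) (s : Fin n) → toℕ s < toℕ v → toℕ (punchIn v s) ≡ toℕ s
toℕ-punchIn-< (suc v) zero    _         = refl
toℕ-punchIn-< (suc v) (suc s) (s≤s s<v) = cong suc (toℕ-punchIn-< v s s<v)

prepend : ∀ {m} → Fin (suc m) → Word m → Word (suc m)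
prepend v σ = v ∷ Vec.map (punchIn v) σ

Vec-map-injective : ∀ {A B : Set} {n} (f : A → B) → (∀ {a a′} → f a ≡ f a′ → a ≡ a′) →
  {u v : Vec A n} → Vec.map f u ≡ Vec.map f v → u ≡ v
Vec-map-injective f f-inj {[]}    {[]}    _  = refl
Vec-map-injective f f-inj {_ ∷ _} {_ ∷ _} eq =
  cong₂ _∷_ (f-inj (∷-injectiveˡ eq)) (Vec-map-injective f f-inj (∷-injectiveʳ eq))

prepend-injective : ∀ {m} (v : Fin (suc m)) {σ σ′ : Word m} → prepend v σ ≡ prepend v σ′ → σ ≡ σ′
prepend-injective v eq = Vec-map-injective (punchIn v) (punchIn-injective v _ _) (∷-injectiveʳ eq)

IsPerm-prepend : ∀ {m} (v : Fin (suc m)) {σ : Word m} → IsPerm σ → IsPerm (prepend v σ)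
IsPerm-prepend v {σ} perm = injective
  where
  shifted : ∀ i → lookup (Vec.map (punchIn v) σ) i ≡ punchIn v (lookup σ i)
  shifted i = lookup-map i (punchIn v) σ
  injective : IsPerm (prepend v σ)
  injective zero    zero    _  = refl
  injective zero    (suc j) eq = contradiction (sym (trans eq (shifted j))) (punchInᵢ≢i v _)
  injective (suc i) zero    eq = contradiction (trans (sym (shifted i)) eq) (punchInᵢ≢i v _)
  injective (suc i) (suc j) eq =
    cong suc (perm i j (punchIn-injective v _ _ (trans (sym (shifted i)) (trans eq (shifted j)))))

IsPerm-prepend⁻ : ∀ {m} (v : Fin (suc m)) {σ : Word m} → IsPerm (prepend v σ) → IsPerm σ
IsPerm-prepend⁻ v {σ} perm i j eq = Finₚ.suc-injective (perm (suc i) (suc j)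
  (trans (lookup-map i (punchIn v) σ) (trans (cong (punchIn v) eq) (sym (lookup-map j (punchIn v) σ)))))

IsPerm⇒prepend : ∀ {m} {v : Fin (suc m)} {τ} → IsPerm (v ∷ τ) → ∃[ σ ] v ∷ τ ≡ prepend v σ
IsPerm⇒prepend {v = v} {τ} perm = σ , cong (v ∷_) (sym (begin
  Vec.map (punchIn v) σ                              ≡⟨ tabulate-∘ (punchIn v) (λ i → punchOut (v≢τ i)) ⟨
  tabulate (λ i → punchIn v (punchOut (v≢τ i)))      ≡⟨ tabulate-cong (λ i → punchIn-punchOut (v≢τ i)) ⟩
  tabulate (lookup τ)                                ≡⟨ tabulate∘lookup τ ⟩
  τ                                                  ∎))
  where
  v≢τ : ∀ i → v ≢ lookup τ i
  v≢τ i eq with perm zero (suc i) eq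
  ... | ()
  σ = tabulate (λ i → punchOut (v≢τ i))

∈-concat-tabulate⁻ : ∀ {A : Set} {n} (F : Fin n → List A) {x} →
  x ∈ List.concat (List.tabulate F) → ∃[ i ] x ∈ F i
∈-concat-tabulate⁻ F x∈ with ∈-concat⁻′ (List.tabulate F) x∈
... | xs , x∈xs , xs∈ with ∈-tabulate⁻ xs∈
... | i , refl = i , x∈xs

∈-concat-tabulate⁺ : ∀ {A : Set} {n} (F : Fin n → List A) {x} i →
  x ∈ F i → x ∈ List.concat (List.tabulate F)
∈-concat-tabulate⁺ F i x∈ = ∈-concat⁺′ x∈ (∈-tabulate⁺ i)

length-concat-tabulate : ∀ {A : Set} {n} (F : Fin n → List A) →
  length (List.concat (List.tabulate F)) ≡ ∑[ i < n ] length (F i)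
length-concat-tabulate {n = zero}  F = refl
length-concat-tabulate {n = suc n} F =
  trans (length-++ (F zero)) (cong (length (F zero) +_) (length-concat-tabulate (F ∘ suc)))

concat-tabulate-unique : ∀ {A : Set} {n} (F : Fin n → List A) → (∀ i → Unique (F i)) →
  (∀ {i j x} → x ∈ F i → x ∈ F j → i ≡ j) → Unique (List.concat (List.tabulate F))
concat-tabulate-unique F unique disjoint =
  concat⁺ (Allₚ.tabulate⁺ unique)
          (tabulate⁺-< λ i<j (x∈i , x∈j) → Finₚ.<⇒≢ i<j (disjoint x∈i x∈j))

∈-if⁻ : ∀ {A : Set} b {xs : List A} {x} → x ∈ (if b then xs else []) → T b × x ∈ xs
∈-if⁻ true x∈ = _ , x∈

∈-if⁺ : ∀ {A : Set} {b} {xs : List A} {x} → T b → x ∈ xs → x ∈ (if b then xs else [])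
∈-if⁺ {b = true} _ x∈ = x∈

if-unique : ∀ {A : Set} b {xs : List A} → Unique xs → Unique (if b then xs else [])
if-unique true  u = u
if-unique false _ = []

-- Avoiders of 32-1 and 21-3 by their first letters

allowed⇒ : ∀ m x y → T (allowed m x y) → x ≤ y ⊎ (m < x × y ≡ 0)
allowed⇒ m x y ok with x ≤ᵇ m in x≤ᵇm
... | true  = inj₁ (≤ᵇ⇒≤ x y ok)
... | false = inj₂ (≰⇒> (λ x≤m → subst T x≤ᵇm (≤⇒≤ᵇ x≤m)) , ≡ᵇ⇒≡ y 0 ok)

allowed-ascent : ∀ {m x y} → x ≤ y → y ≤ m → T (allowed m x y)
allowed-ascent {m} {x} {y} x≤y y≤m
  rewrite dec-true (x ≤? m) (≤-trans x≤y y≤m) | dec-true (x ≤? y) x≤y = _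

allowed-top : ∀ m → T (allowed m (suc m) 0)
allowed-top m rewrite dec-false (suc m ≤? m) (<-irrefl refl) = _

Avoiding : ∀ {n} → (Word n → Set) → (Word n → Set) → Word n → Set
Avoiding P Q w = IsPerm w × ¬ P w × ¬ Q w

Avoids-32-1-21-3 : ∀ {n} → Word n → Set
Avoids-32-1-21-3 = Avoiding (λ w → Contains-xy-z w 3 2 1) (λ w → Contains-xy-z w 2 1 3)

descent-extremes : ∀ {m} {a b : Fin (2+ m)} {τ} → Avoids-32-1-21-3 (a ∷ b ∷ τ) → b Fin.< a →
  toℕ a ≡ suc m × toℕ b ≡ 0
descent-extremes {m} {a} {b} {τ} (perm , no321 , no213) b<a = a-max , b-min
  where
  front : ∀ {x y z} k → SameOrder (toℕ a) (toℕ b) (toℕ (lookup τ k)) x y z →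
    Contains-xy-z (a ∷ b ∷ τ) x y z
  front k ord = from (Contains-xy-z′-∷∷ a b τ) (inj₂ (k , ord))
  above-b : ∀ k → b Fin.< lookup τ k
  above-b k = ≤∧≢⇒< (≮⇒≥ λ τ<b → no321 (front k (SameOrder-321 τ<b b<a)))
                    (IsPerm-distinct (a ∷ b ∷ τ) perm {suc zero} {suc (suc k)} λ ())
  below-a : ∀ k → lookup τ k Fin.< a
  below-a k = ≤∧≢⇒< (≮⇒≥ λ a<τ → no213 (front k (SameOrder-213 b<a a<τ)))
                    (IsPerm-distinct (a ∷ b ∷ τ) perm {suc (suc k)} {zero} λ ())
  toℕ-max : ∀ {c} → c ≡ Fin.fromℕ (suc m) → toℕ c ≡ suc m
  toℕ-max refl = toℕ-fromℕ (suc m)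
  nothing-above : ∀ {c x : Fin (2+ m)} → toℕ c ≡ suc m → ¬ c Fin.< x
  nothing-above {c} {x} c≡1+m c<x = <⇒≱ c<x (subst (toℕ x ≤_) (sym c≡1+m) (≤-pred (toℕ<n x)))
  a-max : toℕ a ≡ suc m
  a-max with IsPerm-surjective (a ∷ b ∷ τ) perm (Fin.fromℕ (suc m))
  ... | zero        , eq = toℕ-max eq
  ... | suc zero    , eq = contradiction b<a (nothing-above (toℕ-max eq))
  ... | suc (suc k) , eq = contradiction (below-a k) (nothing-above (toℕ-max eq))
  b-min : toℕ b ≡ 0
  b-min with IsPerm-surjective (a ∷ b ∷ τ) perm zero
  ... | zero        , refl = contradiction b<a n≮0
  ... | suc zero    , eq   = cong toℕ eq
  ... | suc (suc k) , eq   = contradiction (subst (toℕ b <_) (cong toℕ eq) (above-b k)) n≮0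

prepend-avoids : ∀ {m} (v : Fin (2+ m)) (s : Fin (suc m)) (ρ : Vec (Fin (suc m)) m) →
  Avoids-32-1-21-3 (s ∷ ρ) → T (allowed m (toℕ v) (toℕ s)) → Avoids-32-1-21-3 (prepend v (s ∷ ρ))
prepend-avoids {m} v s ρ (perm , no321 , no213) ok = perm′ , avoid no321 front-321 , avoid no213 front-213
  where
  τ = Vec.map (punchIn v) ρ
  perm′ = IsPerm-prepend v perm
  first = toℕ v
  second = toℕ (punchIn v s)
  rest : Fin m → ℕ
  rest k = toℕ (lookup τ k)
  front : first < second ⊎ (m < first × second ≡ 0)
  front with allowed⇒ m first (toℕ s) ok
  ... | inj₁ v≤s         = inj₁ (subst (first <_) (sym (toℕ-punchIn-≥ v s v≤s)) (s≤s v≤s))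
  ... | inj₂ (m<v , s≡0) =
    inj₂ (m<v , trans (toℕ-punchIn-< v s (subst (_< first) (sym s≡0) (≤-trans z<s m<v))) s≡0)
  above-second : ∀ k → second ≡ 0 → second < rest k
  above-second k second≡0 = subst (_< rest k) (sym second≡0) (n≢0⇒n>0 λ rest≡0 →
    IsPerm-distinct (prepend v (s ∷ ρ)) perm′ {suc zero} {suc (suc k)} (λ ()) (trans second≡0 (sym rest≡0)))
  front-321 : ∀ k → ¬ SameOrder first second (rest k) 3 2 1
  front-321 k (ab , _ , bc) with front
  ... | inj₁ ascent          = from-no (3 <? 2) (to ab ascent)
  ... | inj₂ (_ , second≡0) = from-no (2 <? 1) (to bc (above-second k second≡0))
  front-213 : ∀ k → ¬ SameOrder first second (rest k) 2 1 3
  front-213 k (ab , ac , _) with front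
  ... | inj₁ ascent          = from-no (2 <? 1) (to ab ascent)
  ... | inj₂ (m<first , _)  =
    <⇒≱ (from ac (from-yes (2 <? 3))) (≤-trans (≤-pred (toℕ<n (lookup τ k))) m<first)
  avoid : ∀ {x y z} → ¬ Contains-xy-z (s ∷ ρ) x y z → (∀ k → ¬ SameOrder first second (rest k) x y z) →
    ¬ Contains-xy-z (prepend v (s ∷ ρ)) x y z
  avoid no-tail no-front occ with to (Contains-xy-z′-∷∷ v (punchIn v s) τ) occ
  ... | inj₁ occ′      = no-tail (to (Contains-xy-z′-map (punchIn v) (punchIn-<-⇔ v) (s ∷ ρ)) occ′)
  ... | inj₂ (k , ord) = no-front k ord

prepend-avoids⁻ : ∀ {m} (v : Fin (2+ m)) (s : Fin (suc m)) (ρ : Vec (Fin (suc m)) m) →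
  Avoids-32-1-21-3 (prepend v (s ∷ ρ)) → Avoids-32-1-21-3 (s ∷ ρ) × T (allowed m (toℕ v) (toℕ s))
prepend-avoids⁻ {m} v s ρ avoids@(perm , no321 , no213) =
  (IsPerm-prepend⁻ v perm , no321 ∘ lift , no213 ∘ lift) , ok
  where
  lift : ∀ {x y z} → Contains-xy-z (s ∷ ρ) x y z → Contains-xy-z (prepend v (s ∷ ρ)) x y z
  lift c = from (Contains-xy-z′-∷∷ v (punchIn v s) (Vec.map (punchIn v) ρ))
             (inj₁ (from (Contains-xy-z′-map (punchIn v) (punchIn-<-⇔ v) (s ∷ ρ)) c))
  ok : T (allowed m (toℕ v) (toℕ s))
  ok with toℕ v ≤? toℕ s
  ... | yes v≤s = allowed-ascent v≤s (≤-pred (toℕ<n s))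
  ... | no  v≰s = subst₂ (λ x y → T (allowed m x y)) (sym v≡1+m) (sym s≡0) (allowed-top m)
    where
    s<v = ≰⇒> v≰s
    extremes = descent-extremes avoids (subst (_< toℕ v) (sym (toℕ-punchIn-< v s s<v)) s<v)
    v≡1+m = proj₁ extremes
    s≡0 = trans (sym (toℕ-punchIn-< v s s<v)) (proj₂ extremes)

avoidersStartingWith : ∀ m → Fin (suc m) → List (Word (suc m))
avoidersStartingWith₂ : ∀ m → Fin (2+ m) → Fin (suc m) → List (Word (2+ m))

avoidersStartingWith zero    _ = [ zero ∷ [] ]
avoidersStartingWith (suc m) v = List.concat (List.tabulate (avoidersStartingWith₂ m v))

avoidersStartingWith₂ m v s =
  if allowed m (toℕ v) (toℕ s) then List.map (prepend v) (avoidersStartingWith m s) else []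

avoids-singleton : Avoids-32-1-21-3 (zero ∷ [])
avoids-singleton =
  (λ { zero zero _ → refl }) , (λ { (_ , zero , _ , () , _) }) , (λ { (_ , zero , _ , () , _) })

∈-avoidersStartingWith₂⁻ : ∀ m v s {w} → w ∈ avoidersStartingWith₂ m v s →
  T (allowed m (toℕ v) (toℕ s)) × ∃[ σ ] σ ∈ avoidersStartingWith m s × w ≡ prepend v σ
∈-avoidersStartingWith₂⁻ m v s w∈ with ∈-if⁻ (allowed m (toℕ v) (toℕ s)) w∈
... | ok , w∈map = ok , ∈-map⁻ (prepend v) w∈map

∈-avoidersStartingWith : ∀ m v (w : Word (suc m)) →
  w ∈ avoidersStartingWith m v ⇔ (Avoids-32-1-21-3 w × Vec.head w ≡ v)
∈-avoidersStartingWith zero zero (zero ∷ []) =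
  mk⇔ (λ { (here refl) → avoids-singleton , refl }) (λ _ → here refl)
∈-avoidersStartingWith (suc m) v w = mk⇔ sound (complete w)
  where
  sound : w ∈ avoidersStartingWith (suc m) v → Avoids-32-1-21-3 w × Vec.head w ≡ v
  sound w∈ with ∈-concat-tabulate⁻ (avoidersStartingWith₂ m v) w∈
  ... | s , w∈₂ with ∈-avoidersStartingWith₂⁻ m v s w∈₂
  ... | ok , s′ ∷ ρ , σ∈ , refl with to (∈-avoidersStartingWith m s (s′ ∷ ρ)) σ∈
  ... | avoids , refl = prepend-avoids v s ρ avoids ok , refl
  complete : ∀ w → Avoids-32-1-21-3 w × Vec.head w ≡ v → w ∈ avoidersStartingWith (suc m) v
  complete (_ ∷ τ) (avoids , refl) with IsPerm⇒prepend (proj₁ avoids)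
  ... | s ∷ ρ , refl with prepend-avoids⁻ v s ρ avoids
  ... | avoidsσ , ok = ∈-concat-tabulate⁺ (avoidersStartingWith₂ m v) s
    (∈-if⁺ ok (∈-map⁺ (prepend v) (from (∈-avoidersStartingWith m s (s ∷ ρ)) (avoidsσ , refl))))

head-∈-avoidersStartingWith : ∀ {m v w} → w ∈ avoidersStartingWith m v → Vec.head w ≡ v
head-∈-avoidersStartingWith {m} {v} {w} w∈ = proj₂ (to (∈-avoidersStartingWith m v w) w∈)

avoidersStartingWith-unique : ∀ m v → Unique (avoidersStartingWith m v)
avoidersStartingWith-unique zero    _ = All.[] ∷ []
avoidersStartingWith-unique (suc m) v =
  concat-tabulate-unique (avoidersStartingWith₂ m v)
    (λ s → if-unique (allowed m (toℕ v) (toℕ s))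
                     (map⁺ (prepend-injective v) (avoidersStartingWith-unique m s)))
    disjoint
  where
  disjoint : ∀ {s s′ w} → w ∈ avoidersStartingWith₂ m v s → w ∈ avoidersStartingWith₂ m v s′ →
    s ≡ s′
  disjoint {s} {s′} w∈ w∈′
    with ∈-avoidersStartingWith₂⁻ m v s w∈ | ∈-avoidersStartingWith₂⁻ m v s′ w∈′
  ... | _ , σ , σ∈ , refl | _ , σ′ , σ′∈ , eq with prepend-injective v eq
  ... | refl = trans (sym (head-∈-avoidersStartingWith σ∈)) (head-∈-avoidersStartingWith σ′∈)

length-avoidersStartingWith : ∀ m v → length (avoidersStartingWith m v) ≡ count m (toℕ v)
length-avoidersStartingWith zero    zero = refl
length-avoidersStartingWith (suc m) v =
  trans (length-concat-tabulate (avoidersStartingWith₂ m v)) (sum-cong-≗ {suc m} length-block)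
  where
  length-block : ∀ s →
    length (avoidersStartingWith₂ m v s) ≡ (if allowed m (toℕ v) (toℕ s) then count m (toℕ s) else 0)
  length-block s with allowed m (toℕ v) (toℕ s)
  ... | true  = trans (length-map (prepend v) (avoidersStartingWith m s)) (length-avoidersStartingWith m s)
  ... | false = refl

Enumeration : ∀ {A : Set} → (A → Set) → ℕ → Set
Enumeration {A} P c = ∃[ L ] Unique L × length L ≡ c × (∀ (x : A) → x ∈ L ⇔ P x)

avoiders : ∀ n → List (Word n)
avoiders zero    = [ [] ]
avoiders (suc m) = List.concat (List.tabulate (avoidersStartingWith m))

enumeration-32-1-21-3 : ∀ n → Enumeration (Avoids-32-1-21-3 {n}) (b n)
enumeration-32-1-21-3 zero = avoiders zero , All.[] ∷ [] , refl ,
  λ { [] → mk⇔ (λ _ → (λ ()) , (λ ()) , (λ ())) (λ _ → here refl) }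
enumeration-32-1-21-3 (suc m) = avoiders (suc m) , unique , len , mem
  where
  unique = concat-tabulate-unique (avoidersStartingWith m) (avoidersStartingWith-unique m)
             λ w∈ w∈′ → trans (sym (head-∈-avoidersStartingWith w∈)) (head-∈-avoidersStartingWith w∈′)
  len = begin
    length (avoiders (suc m))                     ≡⟨ length-concat-tabulate (avoidersStartingWith m) ⟩
    ∑[ v ≤ m ] length (avoidersStartingWith m v)  ≡⟨ sum-cong-≗ {suc m} (length-avoidersStartingWith m) ⟩
    count (suc m) 0                               ≡⟨ count≡b (suc m) ⟩
    b (suc m)                                     ∎
  mem : ∀ w → w ∈ avoiders (suc m) ⇔ Avoids-32-1-21-3 w
  mem w = mk⇔
    (λ w∈ → let v , w∈v = ∈-concat-tabulate⁻ (avoidersStartingWith m) w∈ in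
            proj₁ (to (∈-avoidersStartingWith m v w) w∈v))
    (λ avoids → ∈-concat-tabulate⁺ (avoidersStartingWith m) (Vec.head w)
                  (from (∈-avoidersStartingWith m (Vec.head w) w) (avoids , refl)))

-- Reversal and complementation

enumeration-map : ∀ {A : Set} {P Q : A → Set} {c} (t : A → A) → (∀ x → t (t x) ≡ x) →
  (∀ {x} → P x → Q (t x)) → (∀ {x} → Q x → P (t x)) → Enumeration Q c → Enumeration P c
enumeration-map {P = P} t t-involutive P⇒Q Q⇒P (L , unique , len , mem) =
  List.map t L , map⁺ t-injective unique , trans (length-map t L) len , mem′
  where
  t-injective : ∀ {x y} → t x ≡ t y → x ≡ y
  t-injective {x} {y} eq = trans (sym (t-involutive x)) (trans (cong t eq) (t-involutive y))
  mem′ : ∀ x → x ∈ List.map t L ⇔ P x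
  mem′ x = mk⇔
    (λ x∈ → let y , y∈ , x≡ty = ∈-map⁻ t x∈ in subst P (sym x≡ty) (Q⇒P (to (mem y) y∈)))
    (λ px → subst (_∈ List.map t L) (t-involutive x) (∈-map⁺ t (from (mem (t x)) (P⇒Q px))))

enumeration-cong : ∀ {A : Set} {P Q : A → Set} {c} → (∀ {x} → P x → Q x) → (∀ {x} → Q x → P x) →
  Enumeration P c → Enumeration Q c
enumeration-cong P⇒Q Q⇒P (L , unique , len , mem) =
  L , unique , len , λ x → mk⇔ (P⇒Q ∘ to (mem x)) (from (mem x) ∘ Q⇒P)

enumeration-symmetry : ∀ {n} {P Q P′ Q′ : Word n → Set} {c} (t : Word n → Word n) →
  (∀ w → t (t w) ≡ w) → (∀ w → IsPerm w → IsPerm (t w)) →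
  (∀ w → IsPerm w → P w → P′ (t w)) → (∀ w → IsPerm w → P′ w → P (t w)) →
  (∀ w → IsPerm w → Q w → Q′ (t w)) → (∀ w → IsPerm w → Q′ w → Q (t w)) →
  Enumeration (Avoiding P′ Q′) c → Enumeration (Avoiding P Q) c
enumeration-symmetry {n} t t-involutive t-perm P⇒P′ P′⇒P Q⇒Q′ Q′⇒Q =
  enumeration-map t t-involutive (transfer P′⇒P Q′⇒Q) (transfer P⇒P′ Q⇒Q′)
  where
  transfer : ∀ {R S R′ S′ : Word n → Set} →
    (∀ w → IsPerm w → R′ w → R (t w)) → (∀ w → IsPerm w → S′ w → S (t w)) →
    ∀ {w} → Avoiding R S w → Avoiding R′ S′ (t w)
  transfer {R} {S} R′⇒R S′⇒S {w} (perm , ¬r , ¬s) =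
    t-perm w perm ,
    (λ r′ → ¬r (subst R (t-involutive w) (R′⇒R (t w) (t-perm w perm) r′))) ,
    (λ s′ → ¬s (subst S (t-involutive w) (S′⇒S (t w) (t-perm w perm) s′)))

opposite-<-⇔ : ∀ {n} (i j : Fin n) → opposite i Fin.< opposite j ⇔ j Fin.< i
opposite-<-⇔ {n} i j rewrite opposite-prop i | opposite-prop j = mk⇔
  (λ lt → ≰⇒> λ i≤j → <⇒≱ lt (∸-monoʳ-≤ n (s≤s i≤j)))
  (λ j<i → ∸-monoʳ-< (s≤s j<i) (toℕ<n i))

opposite-adjacent : ∀ {n} {i j : Fin n} → toℕ j ≡ suc (toℕ i) →
  toℕ (opposite i) ≡ suc (toℕ (opposite j))
opposite-adjacent {n} {i} {j} j≡1+i = begin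
  toℕ (opposite i)          ≡⟨ opposite-prop i ⟩
  n ∸ suc (toℕ i)           ≡⟨ +-∸-assoc 1 (subst (_< n) j≡1+i (toℕ<n j)) ⟩
  suc (n ∸ suc (suc (toℕ i))) ≡⟨ cong (λ k → suc (n ∸ suc k)) j≡1+i ⟨
  suc (n ∸ suc (toℕ j))     ≡⟨ cong suc (opposite-prop j) ⟨
  suc (toℕ (opposite j))    ∎

opposite-injective : ∀ {n} {i j : Fin n} → opposite i ≡ opposite j → i ≡ j
opposite-injective {i = i} {j} eq =
  trans (sym (opposite-involutive i)) (trans (cong opposite eq) (opposite-involutive j))

complement : ∀ {n} → Word n → Word n
complement = Vec.map opposite

complement-involutive : ∀ {n} (w : Word n) → complement (complement w) ≡ w
complement-involutive w = begin
  Vec.map opposite (Vec.map opposite w) ≡⟨ map-∘ opposite opposite w ⟨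
  Vec.map (opposite ∘ opposite) w       ≡⟨ map-cong opposite-involutive w ⟩
  Vec.map id w                          ≡⟨ map-id w ⟩
  w                                     ∎

IsPerm-complement : ∀ {n} (w : Word n) → IsPerm w → IsPerm (complement w)
IsPerm-complement w perm i j eq =
  perm i j (opposite-injective (trans (sym (lookup-map i opposite w)) (trans eq (lookup-map j opposite w))))

Complementary : ℕ → ℕ → ℕ → ℕ → ℕ → ℕ → Set
Complementary x y z x′ y′ z′ = Distinct x y z × OppositeOrder x y z x′ y′ z′

complement-xy-z : ∀ {n} (w : Word n) → IsPerm w → ∀ {x y z x′ y′ z′} →
  Complementary x y z x′ y′ z′ → Contains-xy-z w x y z → Contains-xy-z (complement w) x′ y′ z′
complement-xy-z w perm (distinct , opp) (i , j , k , j≡1+i , j<k , ord) =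
  i , j , k , j≡1+i , j<k ,
  SameOrder-opposite (IsPerm-Distinct w perm (≤-reflexive (sym j≡1+i)) j<k) distinct
    (reversed i j , reversed i k , reversed j k) opp ord
  where
  reversed : ∀ p q → lookup (complement w) p Fin.< lookup (complement w) q ⇔ lookup w q Fin.< lookup w p
  reversed p q rewrite lookup-map p opposite w | lookup-map q opposite w =
    opposite-<-⇔ (lookup w p) (lookup w q)

reverse : ∀ {n} → Word n → Word n
reverse w = tabulate (λ i → lookup w (opposite i))

lookup-reverse : ∀ {n} (w : Word n) i → lookup (reverse w) (opposite i) ≡ lookup w i
lookup-reverse w i = trans (lookup∘tabulate _ (opposite i)) (cong (lookup w) (opposite-involutive i))

reverse-involutive : ∀ {n} (w : Word n) → reverse (reverse w) ≡ w
reverse-involutive w = trans (tabulate-cong (lookup-reverse w)) (tabulate∘lookup w)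

IsPerm-reverse : ∀ {n} (w : Word n) → IsPerm w → IsPerm (reverse w)
IsPerm-reverse w perm i j eq = opposite-injective (perm (opposite i) (opposite j) (begin
  lookup w (opposite i)             ≡⟨ lookup∘tabulate _ i ⟨
  lookup (reverse w) i              ≡⟨ eq ⟩
  lookup (reverse w) j              ≡⟨ lookup∘tabulate _ j ⟩
  lookup w (opposite j)             ∎))

reverse-x-yz : ∀ {n} (w : Word n) → IsPerm w → ∀ {x y z} → Distinct x y z →
  Contains-x-yz w x y z → Contains-xy-z (reverse w) z y x
reverse-x-yz w perm distinct (i , j , k , i<j , k≡1+j , ord) =
  opposite k , opposite j , opposite i , opposite-adjacent k≡1+j , from (opposite-<-⇔ j i) i<j , ord′
  where
  ord′ : SameOrder (toℕ (lookup (reverse w) (opposite k))) (toℕ (lookup (reverse w) (opposite j)))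
                   (toℕ (lookup (reverse w) (opposite i))) _ _ _
  ord′ rewrite lookup-reverse w i | lookup-reverse w j | lookup-reverse w k =
    SameOrder-reverse (IsPerm-Distinct w perm i<j (≤-reflexive (sym k≡1+j))) distinct ord

reverse-xy-z : ∀ {n} (w : Word n) → IsPerm w → ∀ {x y z} → Distinct x y z →
  Contains-xy-z w x y z → Contains-x-yz (reverse w) z y x
reverse-xy-z w perm distinct (i , j , k , j≡1+i , j<k , ord) =
  opposite k , opposite j , opposite i , from (opposite-<-⇔ k j) j<k , opposite-adjacent j≡1+i , ord′
  where
  ord′ : SameOrder (toℕ (lookup (reverse w) (opposite k))) (toℕ (lookup (reverse w) (opposite j)))
                   (toℕ (lookup (reverse w) (opposite i))) _ _ _
  ord′ rewrite lookup-reverse w i | lookup-reverse w j | lookup-reverse w k =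
    SameOrder-reverse (IsPerm-Distinct w perm (≤-reflexive (sym j≡1+i)) j<k) distinct ord

Distinct-reverse : ∀ {x y z} → Distinct x y z → Distinct z y x
Distinct-reverse (x≢y , x≢z , y≢z) = ≢-sym y≢z , ≢-sym x≢z , ≢-sym x≢y

enumeration-reverse : ∀ {n c x y z x′ y′ z′} → Distinct x y z → Distinct x′ y′ z′ →
  Enumeration (Avoiding {n} (λ w → Contains-xy-z w z y x) (λ w → Contains-xy-z w z′ y′ x′)) c →
  Enumeration (Avoiding (λ w → Contains-x-yz w x y z) (λ w → Contains-x-yz w x′ y′ z′)) c
enumeration-reverse distinct distinct′ = enumeration-symmetry reverse reverse-involutive IsPerm-reverse
  (λ w p → reverse-x-yz w p distinct)  (λ w p → reverse-xy-z w p (Distinct-reverse distinct))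
  (λ w p → reverse-x-yz w p distinct′) (λ w p → reverse-xy-z w p (Distinct-reverse distinct′))

enumeration-complement : ∀ {n c x y z x′ y′ z′ x̄ ȳ z̄ x̄′ ȳ′ z̄′} →
  Complementary x y z x̄ ȳ z̄ → Complementary x̄ ȳ z̄ x y z →
  Complementary x′ y′ z′ x̄′ ȳ′ z̄′ → Complementary x̄′ ȳ′ z̄′ x′ y′ z′ →
  Enumeration (Avoiding {n} (λ w → Contains-xy-z w x̄ ȳ z̄) (λ w → Contains-xy-z w x̄′ ȳ′ z̄′)) c →
  Enumeration (Avoiding (λ w → Contains-xy-z w x y z) (λ w → Contains-xy-z w x′ y′ z′)) c
enumeration-complement to-P from-P to-Q from-Q =
  enumeration-symmetry complement complement-involutive IsPerm-complement
    (λ w p → complement-xy-z w p to-P) (λ w p → complement-xy-z w p from-P)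
    (λ w p → complement-xy-z w p to-Q) (λ w p → complement-xy-z w p from-Q)

enumeration-12-3-23-1 : ∀ n →
  Enumeration (Avoiding (λ w → Contains-xy-z w 1 2 3) (λ w → Contains-xy-z w 2 3 1)) (b n)
enumeration-12-3-23-1 n = enumeration-complement 123↦321 321↦123 231↦213 213↦231 (enumeration-32-1-21-3 n)
  where
  123↦321 : Complementary 1 2 3 3 2 1
  123↦321 = ((λ ()) , (λ ()) , (λ ())) , <-⇔-by-<ᵇ refl , <-⇔-by-<ᵇ refl , <-⇔-by-<ᵇ refl
  321↦123 : Complementary 3 2 1 1 2 3
  321↦123 = ((λ ()) , (λ ()) , (λ ())) , <-⇔-by-<ᵇ refl , <-⇔-by-<ᵇ refl , <-⇔-by-<ᵇ refl
  231↦213 : Complementary 2 3 1 2 1 3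
  231↦213 = ((λ ()) , (λ ()) , (λ ())) , <-⇔-by-<ᵇ refl , <-⇔-by-<ᵇ refl , <-⇔-by-<ᵇ refl
  213↦231 : Complementary 2 1 3 2 3 1
  213↦231 = ((λ ()) , (λ ()) , (λ ())) , <-⇔-by-<ᵇ refl , <-⇔-by-<ᵇ refl , <-⇔-by-<ᵇ refl

enumeration-23-1-12-3 : ∀ n →
  Enumeration (Avoiding (λ w → Contains-xy-z w 2 3 1) (λ w → Contains-xy-z w 1 2 3)) (b n)
enumeration-23-1-12-3 n =
  enumeration-cong (λ (perm , ¬p , ¬q) → perm , ¬q , ¬p) (λ (perm , ¬p , ¬q) → perm , ¬q , ¬p)
    (enumeration-12-3-23-1 n)

enumeration-1-23-3-12 : ∀ n →
  Enumeration (Avoiding (λ w → Contains-x-yz w 1 2 3) (λ w → Contains-x-yz w 3 1 2)) (b n)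
enumeration-1-23-3-12 n =
  enumeration-reverse ((λ ()) , (λ ()) , (λ ())) ((λ ()) , (λ ()) , (λ ())) (enumeration-32-1-21-3 n)

enumeration-3-21-1-32 : ∀ n →
  Enumeration (Avoiding (λ w → Contains-x-yz w 3 2 1) (λ w → Contains-x-yz w 1 3 2)) (b n)
enumeration-3-21-1-32 n =
  enumeration-reverse ((λ ()) , (λ ()) , (λ ())) ((λ ()) , (λ ()) , (λ ())) (enumeration-12-3-23-1 n)

mainTheorem14 : (n : ℕ) →
    (∃[ L ] Unique L × length L ≡ b n ×
      (∀ (w : Word n) → (w ∈ L) ⇔ (IsPerm w × ¬ Contains-x-yz w 1 2 3 × ¬ Contains-x-yz w 3 1 2)))
  × (∃[ L ] Unique L × length L ≡ b n ×
      (∀ (w : Word n) → (w ∈ L) ⇔ (IsPerm w × ¬ Contains-x-yz w 3 2 1 × ¬ Contains-x-yz w 1 3 2)))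
  × (∃[ L ] Unique L × length L ≡ b n ×
      (∀ (w : Word n) → (w ∈ L) ⇔ (IsPerm w × ¬ Contains-xy-z w 2 3 1 × ¬ Contains-xy-z w 1 2 3)))
  × (∃[ L ] Unique L × length L ≡ b n ×
      (∀ (w : Word n) → (w ∈ L) ⇔ (IsPerm w × ¬ Contains-xy-z w 3 2 1 × ¬ Contains-xy-z w 2 1 3)))
mainTheorem14 n =
  enumeration-1-23-3-12 n , enumeration-3-21-1-32 n , enumeration-23-1-12-3 n , enumeration-32-1-21-3 n
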